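{- Let $\mathsf{D}$ be an optiongraph. If $p,q\in I_{\mathsf{D}}$, then $p\bowtie q$.
   Context: An optiongraph is a nonempty set $\mathsf{D}$ (of positions, possibly infinite) together with an option function $\mathrm{Opt}:\mathsf{D}\to 2^{\mathsf{D}}$, viewed as a digraph with an arrow $p\to q$ iff $q\in\mathrm{Opt}(p)$. A terminal position is one with empty option set; $q$ is a subposition of $p$ if there is a finite walk (possibly of length $0$) from $p$ to $q$. $I_{\mathsf{D}}$ is the set of positions having no terminal subposition. For an equivalence relation $\theta$, write $[p]$ for the class of $p$ and $[S]:=\{[s]\mid s\in S\}$. An equivalence relation on $\mathsf{D}$ is a congruence relation if $p\mathrel{\theta}q$ implies $[\mathrm{Opt}(p)]=[\mathrm{Opt}(q)]$. $\bowtie$ denotes the union of all congruence relations on $\mathsf{D}$, which is itself a congruence relation (the maximum one). -}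

module Defs where

open import Level using (Level; suc; _⊔_)
open import Data.Product using (Σ; ∃; _×_; _,_)
open import Relation.Nullary using (¬_)
open import Relation.Binary using (Rel; IsEquivalence)
open import Relation.Binary.Construct.Closure.ReflexiveTransitive using (Star)

record Optiongraph (ℓ : Level) : Set (suc ℓ) where
  field
    Pos       : Set ℓ
    Opt       : Pos → Pos → Set ℓ   -- Opt p q  means  q ∈ Opt(p)
    inhabited : Pos

module _ {ℓ : Level} (G : Optiongraph ℓ) where
  open Optiongraph G

  Arrow : Rel Pos ℓ
  Arrow p q = Opt p q

  Terminal : Pos → Set ℓ
  Terminal p = ∀ q → ¬ Opt p q

  Subposition : Pos → Pos → Set ℓ
  Subposition q p = Star Arrow p q

  InI : Pos → Set ℓ
  InI p = ¬ (Σ Pos λ q → Subposition q p × Terminal q)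

  -- [S] = [T] for the class sets of S = Opt p and T = Opt q under θ:
  -- every class of an option of p is the class of an option of q and conversely
  SameClasses : Rel Pos ℓ → Pos → Pos → Set ℓ
  SameClasses θ p q =
    (∀ x → Opt p x → Σ Pos λ y → Opt q y × θ x y) ×
    (∀ y → Opt q y → Σ Pos λ x → Opt p x × θ x y)

  record IsCongruence (θ : Rel Pos ℓ) : Set ℓ where
    field
      isEquivalence : IsEquivalence θ
      compatible    : ∀ {p q} → θ p q → SameClasses θ p q

  _⋈_ : Pos → Pos → Set (suc ℓ)
  p ⋈ q = Σ (Rel Pos ℓ) λ θ → IsCongruence θ × θ p q

{-# OPTIONS --safe #-}
module Submission where

-- I_D is closed under taking options, and (classically) every position of I_D
-- has an option.  Hence the equivalence relation that merges all of I_D into one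
-- class and leaves every other position alone is a congruence, and it relates
-- any two positions of I_D.

open import Defs
open import Level using (Level)
open import Axiom.ExcludedMiddle using (ExcludedMiddle)
open import Data.Product using (Σ; ∃; _×_; _,_)
open import Data.Sum using (_⊎_; inj₁; inj₂)
open import Relation.Nullary.Decidable using (decidable-stable)
open import Relation.Binary using (Rel; IsEquivalence)
open import Relation.Binary.PropositionalEquality using (_≡_; refl; sym)
open import Relation.Binary.Construct.Closure.ReflexiveTransitive using (ε; _◅_)

module _ {ℓ : Level} (G : Optiongraph ℓ) where
  open Optiongraph G

  InI-option : ∀ {p x} → InI G p → Opt p x → InI G x
  InI-option p∈I p→x (t , x→*t , t-terminal) = p∈I (t , p→x ◅ x→*t , t-terminal)

  InI⇒hasOption : ExcludedMiddle ℓ → ∀ {p} → InI G p → ∃ (Opt p)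
  InI⇒hasOption em {p} p∈I =
    decidable-stable em λ noOption → p∈I (p , ε , λ y p→y → noOption (y , p→y))

  module _ (P : Pos → Set ℓ) where

    Merge : Rel Pos ℓ
    Merge x y = (P x × P y) ⊎ x ≡ y

    Merge-isEquivalence : IsEquivalence Merge
    Merge-isEquivalence = record { refl = inj₂ refl ; sym = symmetric ; trans = transitive }
      where
      symmetric : ∀ {x y} → Merge x y → Merge y x
      symmetric (inj₁ (Px , Py)) = inj₁ (Py , Px)
      symmetric (inj₂ x≡y)       = inj₂ (sym x≡y)

      transitive : ∀ {x y z} → Merge x y → Merge y z → Merge x z
      transitive (inj₁ (Px , _)) (inj₁ (_ , Pz)) = inj₁ (Px , Pz)
      transitive xy@(inj₁ _)     (inj₂ refl)     = xy
      transitive (inj₂ refl)     yz              = yz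

    Merge-isCongruence : (∀ {p x} → P p → Opt p x → P x) → (∀ {p} → P p → ∃ (Opt p)) →
                         IsCongruence G Merge
    Merge-isCongruence P-option P⇒hasOption = record
      { isEquivalence = Merge-isEquivalence
      ; compatible    = compatible
      }
      where
      compatible : ∀ {p q} → Merge p q → SameClasses G Merge p q
      compatible (inj₂ refl) = (λ x p→x → x , p→x , inj₂ refl) , (λ y p→y → y , p→y , inj₂ refl)
      compatible {p} {q} (inj₁ (Pp , Pq)) = forth , back
        where
        forth : ∀ x → Opt p x → Σ Pos λ y → Opt q y × Merge x y
        forth x p→x with P⇒hasOption Pq
        ... | y , q→y = y , q→y , inj₁ (P-option Pp p→x , P-option Pq q→y)

        back : ∀ y → Opt q y → Σ Pos λ x → Opt p x × Merge x y
        back y q→y with P⇒hasOption Pp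
        ... | x , p→x = x , p→x , inj₁ (P-option Pp p→x , P-option Pq q→y)

mainTheorem14 : {ℓ : Level} → ExcludedMiddle ℓ → (G : Optiongraph ℓ) →
    (p q : Optiongraph.Pos G) → InI G p → InI G q → _⋈_ G p q
mainTheorem14 em G p q p∈I q∈I =
  Merge G (InI G) ,
  Merge-isCongruence G (InI G) (InI-option G) (InI⇒hasOption G em) ,
  inj₁ (p∈I , q∈I)
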